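{- Let $m\ge1$ and let $k_1,\ldots,k_m$, $n_1,\ldots,n_m$ be integers with $n_i \geq k_i \geq 0$ for all $i \in [m]$. Let $M$ be the complement of a $(k_1, \ldots, k_m ; n_1, \ldots, n_m)$ circulant block diagonal matrix, and let $P$ be a partition of the ones in $M$ into combinatorial rectangles. Suppose that $P$ includes a rectangle that is not balanced in rows (or not balanced in columns) in some block. Then $|P| \geq \mathrm{rank}_{\mathbb{R}}(M) + 1$.
   Context: For integers $n \ge k \ge 0$, $D_{n,k}$ denotes the $n\times n$ circulant $0,1$ matrix whose first row consists of $n-k$ ones followed by $k$ zeros, each subsequent row being the cyclic shift of the previous row by one position to the right. For integers $n_i \ge k_i \ge 0$ ($i\in[m]$), a matrix is called $(k_1,\ldots,k_m;n_1,\ldots,n_m)$ circulant block diagonal if it is a block matrix with $m$ diagonal blocks whose $i$th diagonal block is $D_{n_i,n_i-k_i}$ and all of whose other entries are zero; rows and columns are indexed by pairs $(i,j)$ with $i\in[m]$, $j\in[n_i]$. The complement of a $0,1$ matrix swaps zeros and ones. A combinatorial rectangle of ones is a set $A\times B$ of rows times columns all of whose entries are ones; a partition of the ones into rectangles covers each one-entry exactly once. For a rectangle $R=A\times B$ and $i\in[m]$ with $d_i=\gcd(n_i,k_i)$ (where $\gcd(n,0)=n$), the row sequence of $R$ in block $i$ is $(a_1,\ldots,a_{d_i})$ where $a_t$ is the number of rows $(i,j)\in A$ with $j\equiv t \pmod{d_i}$; $R$ is balanced in rows in block $i$ if $a_1=\cdots=a_{d_i}$. The column sequence and being balanced in columns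 are defined analogously using columns $(i,j)\in B$. $\mathrm{rank}_{\mathbb{R}}$ is the rank over the reals. -}

module Defs where

open import Data.Bool using (Bool; true; false; if_then_else_; not)
open import Data.Nat using (ℕ; zero; suc; _+_; _∸_; _≤_; _<_; _≤ᵇ_; _<ᵇ_; ∣_-_∣)
open import Data.Nat.GCD using (gcd)
open import Data.Nat.Divisibility using (_∣?_)
open import Data.Fin using (Fin; toℕ; _≟_)
open import Data.Product using (Σ; _×_; _,_)
open import Data.Rational using (ℚ; 0ℚ; 1ℚ; _*_) renaming (_+_ to _+ℚ_)
open import Relation.Nullary using (does; yes; no)
open import Relation.Binary.PropositionalEquality using (_≡_)

cdiff : ℕ → ℕ → ℕ → ℕ
cdiff n j j' = if j ≤ᵇ j' then j' ∸ j else (n + j') ∸ j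

-- D_{n,k}: first row = (n-k) ones followed by k zeros; row j is the
-- first row cyclically shifted j positions to the right.
D : (n k : ℕ) → Fin n → Fin n → Bool
D n k j j' = cdiff n (toℕ j) (toℕ j') <ᵇ (n ∸ k)

Idx : (m : ℕ) → (Fin m → ℕ) → Set
Idx m n = Σ (Fin m) (λ i → Fin (n i))

-- (k_1..k_m ; n_1..n_m) circulant block diagonal matrix:
-- i-th diagonal block is D_{n_i, n_i - k_i}, zero elsewhere.
CBD : (m : ℕ) (k n : Fin m → ℕ) → Idx m n → Idx m n → Bool
CBD m k n (i , j) (i' , j') with i ≟ i'
... | yes _ = cdiff (n i) (toℕ j) (toℕ j') <ᵇ (n i ∸ (n i ∸ k i))
... | no _  = false

complement : {I : Set} → (I → I → Bool) → I → I → Bool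
complement M x y = not (M x y)

record Rect (I : Set) : Set where
  constructor rect
  field
    rows : I → Bool
    cols : I → Bool
open Rect public

_∈R_ : {I : Set} → I × I → Rect I → Set
(x , y) ∈R R = (rows R x ≡ true) × (cols R y ≡ true)

IsOneRect : {I : Set} → (I → I → Bool) → Rect I → Set
IsOneRect {I} M R =
  Σ I (λ x → rows R x ≡ true) × Σ I (λ y → cols R y ≡ true) ×
  (∀ x y → rows R x ≡ true → cols R y ≡ true → M x y ≡ true)

IsPartition : {I : Set} → (I → I → Bool) → (p : ℕ) → (Fin p → Rect I) → Set
IsPartition {I} M p P =
  (∀ t → IsOneRect M (P t)) ×
  (∀ x y → M x y ≡ true →
     Σ (Fin p) (λ t → (x , y) ∈R P t) ×
     (∀ t t' → (x , y) ∈R P t → (x , y) ∈R P t' → t ≡ t'))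

sumℕ : (r : ℕ) → (Fin r → ℕ) → ℕ
sumℕ zero f = 0
sumℕ (suc r) f = f Fin.zero + sumℕ r (λ t → f (Fin.suc t))

classCount : {m : ℕ} {n : Fin m → ℕ} → (Idx m n → Bool) → (i : Fin m) → (d s : ℕ) → ℕ
classCount {n = n} S i d s =
  sumℕ (n i) (λ j → if S (i , j) then (if does (d ∣? ∣ toℕ j - s ∣) then 1 else 0) else 0)

-- S (row set or column set) is balanced in block i, d_i = gcd(n_i, k_i)
-- (stdlib: gcd n 0 = n). All residue classes mod d_i have equal counts.
BalancedIn : {m : ℕ} (k n : Fin m → ℕ) → (Idx m n → Bool) → Fin m → Set
BalancedIn k n S i =
  ∀ s s' → s < gcd (n i) (k i) → s' < gcd (n i) (k i) →
    classCount S i (gcd (n i) (k i)) s ≡ classCount S i (gcd (n i) (k i)) s'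

-- Rank over ℚ (equal to the real rank for a 0,1 matrix)

toℚ : Bool → ℚ
toℚ true = 1ℚ
toℚ false = 0ℚ

sumℚ : (r : ℕ) → (Fin r → ℚ) → ℚ
sumℚ zero f = 0ℚ
sumℚ (suc r) f = f Fin.zero +ℚ sumℚ r (λ t → f (Fin.suc t))

RowsIndependent : {I : Set} → (I → I → Bool) → (r : ℕ) → (Fin r → I) → Set
RowsIndependent M r f =
  ∀ (c : Fin r → ℚ) →
    (∀ y → sumℚ r (λ t → c t * toℚ (M (f t) y)) ≡ 0ℚ) →
    ∀ t → c t ≡ 0ℚ

IsRank : {I : Set} → (I → I → Bool) → ℕ → Set
IsRank {I} M r =
  Σ (Fin r → I) (RowsIndependent M r) ×
  (∀ s (f : Fin s → I) → RowsIndependent M s f → s ≤ r)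

-- Write M = ∑ₜ χ(rows Pₜ) ⊗ χ(cols Pₜ). Fix a block i, d = gcd(nᵢ, kᵢ) and residues s, s′ < d, and let
-- u be the vector supported on block i with u(i, j) = [j ≡ s] − [j ≡ s′] (mod d). Restricted to block i,
-- a row or column of M is either identically 1 (when it belongs to another block) or 1 exactly off a cyclic
-- window of kᵢ consecutive indices. Since d divides nᵢ and kᵢ, every residue class mod d meets the whole
-- block and each such window equally often, so uᵀM = 0 and Mu = 0. If the rows of Pₜ are unbalanced in
-- block i, then uᵀχ(rows Pₜ) ≠ 0 for suitable s, s′, so uᵀM = ∑ₜ′ (uᵀχ(rows Pₜ′)) χ(cols Pₜ′) = 0 is a
-- nontrivial relation among the column factors. Eliminating χ(cols Pₜ) writes M as a sum of |P| − 1
-- rank-one matrices, so rank M < |P|. Unbalanced columns are handled in the same way with Mu = 0.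

module Submission where

open import Defs
open import Data.Nat using (ℕ; _≤_; _+_)
open import Data.Fin using (Fin)
open import Data.Product using (Σ; _×_; _,_)
open import Data.Sum using (_⊎_)
open import Data.Empty using (⊥)

open import Algebra.Bundles using (CommutativeRing)
open import Data.Bool using (Bool; true; false; not; if_then_else_)
open import Data.Empty using (⊥-elim)
open import Data.Fin as Fin using (toℕ; zero; suc; punchIn)
open import Data.Fin.Properties using (any?; punchInᵢ≢i; toℕ<n)
open import Data.Nat
open import Data.Nat.Properties
open import Data.Nat.Divisibility using (_∣_; _∣?_; divides; n∣m*n; >⇒∤)
open import Data.Nat.DivMod
  using (_%_; _/_; %-congˡ; [m+n]%n≡m%n; [m+kn]%n≡m%n; m<n⇒m%n≡m; m≡m%n+[m/n]*n)
open import Data.Nat.GCD using (gcd; gcd[m,n]∣m; gcd[m,n]∣n)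
open import Data.Nat.Tactic.RingSolver using (solve-∀)
open import Data.Product using (∃; proj₂)
open import Data.Rational using (ℚ; 0ℚ; 1ℚ)
import Data.Rational as ℚ
import Data.Rational.Properties as ℚ
open import Data.Rational.Solver using (module +-*-Solver)
open import Data.Sum using ([_,_])
open import Data.Vec.Functional using (insertAt)
open import Data.Vec.Functional.Properties using (insertAt-lookup; insertAt-punchIn)
open import Function using (_∘_; flip; _⇔_; mk⇔; Equivalence)
open import Relation.Binary.PropositionalEquality
  using (_≡_; _≢_; refl; sym; trans; cong; cong₂; subst; subst₂; module ≡-Reasoning)
open import Relation.Nullary using (¬_; Dec; does; yes; no; ¬?)
open import Relation.Nullary.Decidable using (decidable-stable; dec-true; dec-false; does-⇔)

open import Algebra.Properties.Semiring.Sum (CommutativeRing.semiring ℚ.+-*-commutativeRing)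
  using (sum; sum-syntax; sum-cong-≗; sum-replicate-zero; ∑-distrib-+; ∑-comm; sum-remove;
         *-distribˡ-sum; *-distribʳ-sum)
import Algebra.Properties.Semiring.Mult (CommutativeRing.semiring ℚ.+-*-commutativeRing) as Mult
open import Algebra.Properties.Group ℚ.+-0-group using (inverseʳ-unique; ∙-cancelˡ; x∙y⁻¹≈ε⇒x≈y)
open import Algebra.Properties.Ring ℚ.+-*-ring using ([y-z]x≈yx-zx)
open +-*-Solver using (solve; _:+_; _:-_; _:*_; :-_; _:=_)
open ≡-Reasoning

-- Linear algebra over ℚ

sumℚ≡sum : ∀ r (f : Fin r → ℚ) → sumℚ r f ≡ sum f
sumℚ≡sum zero    f = refl
sumℚ≡sum (suc r) f = cong (f zero ℚ.+_) (sumℚ≡sum r (f ∘ suc))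

sum-zero : ∀ {r} {f : Fin r → ℚ} → (∀ t → f t ≡ 0ℚ) → sum f ≡ 0ℚ
sum-zero {r} f≗0 = trans (sum-cong-≗ f≗0) (sum-replicate-zero r)

sum-neg : ∀ {r} (f : Fin r → ℚ) → ∑[ t < r ] (ℚ.- f t) ≡ ℚ.- sum f
sum-neg {zero}  f = refl
sum-neg {suc r} f =
  trans (cong (ℚ.- f zero ℚ.+_) (sum-neg (f ∘ suc))) (sym (ℚ.neg-distrib-+ (f zero) (sum (f ∘ suc))))

∑-distrib-- : ∀ {r} (f g : Fin r → ℚ) → ∑[ t < r ] (f t ℚ.- g t) ≡ sum f ℚ.- sum g
∑-distrib-- f g = trans (∑-distrib-+ f (ℚ.-_ ∘ g)) (cong (sum f ℚ.+_) (sum-neg g))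

sum-delta : ∀ {r} {f : Fin r → ℚ} t₀ → (∀ t → t ≢ t₀ → f t ≡ 0ℚ) → sum f ≡ f t₀
sum-delta {suc r} {f} t₀ f≡0 = begin
  sum f                                   ≡⟨ sum-remove f ⟩
  f t₀ ℚ.+ ∑[ t < r ] f (punchIn t₀ t)    ≡⟨ cong (f t₀ ℚ.+_) (sum-zero (λ t → f≡0 _ (punchInᵢ≢i t₀ t))) ⟩
  f t₀ ℚ.+ 0ℚ                             ≡⟨ ℚ.+-identityʳ (f t₀) ⟩
  f t₀                                    ∎

LinearlyDependent : ∀ {r q} → (Fin r → Fin q → ℚ) → Set
LinearlyDependent {r} {q} A =
  Σ (Fin r → ℚ) λ c → (∃ λ s → c s ≢ 0ℚ) × (∀ t → ∑[ s < r ] (c s ℚ.* A s t) ≡ 0ℚ)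

dependent-dropZeroColumn : ∀ {r q} (A : Fin r → Fin (suc q) → ℚ) → (∀ s → A s zero ≡ 0ℚ) →
  LinearlyDependent (λ s t → A s (suc t)) → LinearlyDependent A
dependent-dropZeroColumn A A₀≡0 (c , c≢0 , cA≡0) = c , c≢0 , λ
  { zero    → sum-zero (λ s → trans (cong (c s ℚ.*_) (A₀≡0 s)) (ℚ.*-zeroʳ (c s)))
  ; (suc t) → cA≡0 t }

module Pivot {r q} (A : Fin (suc r) → Fin (suc q) → ℚ) (s₀ : Fin (suc r)) (p≢0 : A s₀ zero ≢ 0ℚ) where

  instance
    _ = ℚ.≢-nonZero p≢0

  μ : Fin r → ℚ
  μ s = A (punchIn s₀ s) zero ℚ.* ℚ.1/ A s₀ zero

  reduced : Fin r → Fin (suc q) → ℚ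
  reduced s t = A (punchIn s₀ s) t ℚ.- μ s ℚ.* A s₀ t

  reduced-pivotColumn : ∀ s → reduced s zero ≡ 0ℚ
  reduced-pivotColumn s = begin
    a ℚ.- a ℚ.* ℚ.1/ p ℚ.* p      ≡⟨ cong (ℚ._-_ a) (ℚ.*-assoc a (ℚ.1/ p) p) ⟩
    a ℚ.- a ℚ.* (ℚ.1/ p ℚ.* p)    ≡⟨ cong (λ z → a ℚ.- a ℚ.* z) (ℚ.*-inverseˡ p) ⟩
    a ℚ.- a ℚ.* 1ℚ                ≡⟨ cong (ℚ._-_ a) (ℚ.*-identityʳ a) ⟩
    a ℚ.- a                       ≡⟨ ℚ.+-inverseʳ a ⟩
    0ℚ                            ∎
    where
    a = A (punchIn s₀ s) zero
    p = A s₀ zero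

  lift : (Fin r → ℚ) → Fin (suc r) → ℚ
  lift c = insertAt c s₀ (ℚ.- ∑[ s < r ] (c s ℚ.* μ s))

  lift-combination : ∀ c t → ∑[ s < suc r ] (lift c s ℚ.* A s t) ≡ ∑[ s < r ] (c s ℚ.* reduced s t)
  lift-combination c t = begin
    ∑[ s < suc r ] (lift c s ℚ.* A s t)
      ≡⟨ sum-remove (λ s → lift c s ℚ.* A s t) ⟩
    lift c s₀ ℚ.* a₀ ℚ.+ ∑[ s < r ] (lift c (punchIn s₀ s) ℚ.* A (punchIn s₀ s) t)
      ≡⟨ cong₂ (λ u v → u ℚ.* a₀ ℚ.+ v) (insertAt-lookup c s₀ _)
               (sum-cong-≗ (λ s → cong (ℚ._* A (punchIn s₀ s) t) (insertAt-punchIn c s₀ _ s))) ⟩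
    ℚ.- X ℚ.* a₀ ℚ.+ T
      ≡⟨ rearrange X a₀ T ⟩
    T ℚ.- X ℚ.* a₀
      ≡⟨ cong (ℚ._-_ T) (*-distribʳ-sum a₀ (λ s → c s ℚ.* μ s)) ⟩
    T ℚ.- ∑[ s < r ] (c s ℚ.* μ s ℚ.* a₀)
      ≡⟨ ∑-distrib-- (λ s → c s ℚ.* A (punchIn s₀ s) t) _ ⟨
    ∑[ s < r ] (c s ℚ.* A (punchIn s₀ s) t ℚ.- c s ℚ.* μ s ℚ.* a₀)
      ≡⟨ sum-cong-≗ (λ s → distrib (c s) _ (μ s) a₀) ⟩
    ∑[ s < r ] (c s ℚ.* reduced s t)
      ∎
    where
    a₀ = A s₀ t
    X = ∑[ s < r ] (c s ℚ.* μ s)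
    T = ∑[ s < r ] (c s ℚ.* A (punchIn s₀ s) t)
    rearrange : ∀ x a y → ℚ.- x ℚ.* a ℚ.+ y ≡ y ℚ.- x ℚ.* a
    rearrange = solve 3 (λ x a y → (:- x) :* a :+ y := y :- x :* a) refl
    distrib : ∀ x y z w → x ℚ.* y ℚ.- x ℚ.* z ℚ.* w ≡ x ℚ.* (y ℚ.- z ℚ.* w)
    distrib = solve 4 (λ x y z w → x :* y :- x :* z :* w := x :* (y :- z :* w)) refl

  dependent-lift : LinearlyDependent (λ s t → reduced s (suc t)) → LinearlyDependent A
  dependent-lift (c , (s₁ , c≢0) , cB≡0) =
    lift c , (punchIn s₀ s₁ , c≢0 ∘ trans (sym (insertAt-punchIn c s₀ _ s₁))) , λ t →
      trans (lift-combination c t) (column t)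
    where
    column : ∀ t → ∑[ s < r ] (c s ℚ.* reduced s t) ≡ 0ℚ
    column zero    = sum-zero (λ s → trans (cong (c s ℚ.*_) (reduced-pivotColumn s)) (ℚ.*-zeroʳ (c s)))
    column (suc t) = cB≡0 t

rows-dependent : ∀ {r q} → q < r → (A : Fin r → Fin q → ℚ) → LinearlyDependent A
rows-dependent {suc r} {zero}  _         A = (λ _ → 1ℚ) , (zero , λ ()) , λ ()
rows-dependent {suc r} {suc q} (s≤s q<r) A with any? (λ s → ¬? (A s zero ℚ.≟ 0ℚ))
... | yes (s₀ , p≢0) = Pivot.dependent-lift A s₀ p≢0 (rows-dependent q<r _)
... | no ∄pivot      = dependent-dropZeroColumn A
  (λ s → decidable-stable (A s zero ℚ.≟ 0ℚ) (∄pivot ∘ (s ,_)))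
  (rows-dependent (m<n⇒m<1+n q<r) (λ s t → A s (suc t)))

Factorises : ∀ {X Y : Set} → (X → Y → ℚ) → ∀ {q} → (Fin q → X → ℚ) → (Fin q → Y → ℚ) → Set
Factorises F {q} a b = ∀ x y → F x y ≡ ∑[ t < q ] (a t x ℚ.* b t y)

RankAtMost : ∀ {X Y : Set} → (X → Y → ℚ) → ℕ → Set
RankAtMost {X} {Y} F q = Σ (Fin q → X → ℚ) λ a → Σ (Fin q → Y → ℚ) λ b → Factorises F a b

factorises-flip : ∀ {X Y : Set} {F : X → Y → ℚ} {q} {a : Fin q → X → ℚ} {b : Fin q → Y → ℚ} →
  Factorises F a b → Factorises (flip F) b a
factorises-flip {a = a} {b} F≡ab y x = trans (F≡ab x y) (sum-cong-≗ (λ t → ℚ.*-comm (a t x) (b t y)))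

rankAtMost-flip : ∀ {X Y : Set} {F : X → Y → ℚ} {q} → RankAtMost F q → RankAtMost (flip F) q
rankAtMost-flip (a , b , F≡ab) = b , a , factorises-flip {a = a} F≡ab

rankAtMost-removeDependent : ∀ {X Y : Set} {F : X → Y → ℚ} {q} {a : Fin (suc q) → X → ℚ} {b} →
  Factorises F a b → (c : Fin (suc q) → ℚ) (t₀ : Fin (suc q)) → c t₀ ≢ 0ℚ →
  (∀ y → ∑[ t < suc q ] (c t ℚ.* b t y) ≡ 0ℚ) → RankAtMost F q
rankAtMost-removeDependent {X = X} {F = F} {q} {a} {b} F≡ab c t₀ c₀≢0 cb≡0 = a′ , b′ , F≡a′b′
  where
  instance
    _ = ℚ.≢-nonZero c₀≢0

  c₀ = c t₀

  μ : Fin q → ℚ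
  μ t = ℚ.1/ c₀ ℚ.* c (punchIn t₀ t)

  a′ : Fin q → X → ℚ
  a′ t x = a (punchIn t₀ t) x ℚ.- a t₀ x ℚ.* μ t

  b′ = b ∘ punchIn t₀

  μb′≡-b₀ : ∀ y → ∑[ t < q ] (μ t ℚ.* b′ t y) ≡ ℚ.- b t₀ y
  μb′≡-b₀ y = begin
    ∑[ t < q ] (μ t ℚ.* b′ t y)                    ≡⟨ sum-cong-≗ (λ t → ℚ.*-assoc (ℚ.1/ c₀) _ (b′ t y)) ⟩
    ∑[ t < q ] (ℚ.1/ c₀ ℚ.* (c (punchIn t₀ t) ℚ.* b′ t y))
      ≡⟨ *-distribˡ-sum (ℚ.1/ c₀) (λ t → c (punchIn t₀ t) ℚ.* b′ t y) ⟨
    ℚ.1/ c₀ ℚ.* ∑[ t < q ] (c (punchIn t₀ t) ℚ.* b′ t y)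
      ≡⟨ cong (ℚ.1/ c₀ ℚ.*_) (inverseʳ-unique (c₀ ℚ.* b t₀ y) _ others≡) ⟩
    ℚ.1/ c₀ ℚ.* ℚ.- (c₀ ℚ.* b t₀ y)                ≡⟨ reassociate (ℚ.1/ c₀) c₀ (b t₀ y) ⟩
    ℚ.- (ℚ.1/ c₀ ℚ.* c₀ ℚ.* b t₀ y)                ≡⟨ cong (λ z → ℚ.- (z ℚ.* b t₀ y)) (ℚ.*-inverseˡ c₀) ⟩
    ℚ.- (1ℚ ℚ.* b t₀ y)                            ≡⟨ cong ℚ.-_ (ℚ.*-identityˡ (b t₀ y)) ⟩
    ℚ.- b t₀ y                                     ∎
    where
    others≡ : c₀ ℚ.* b t₀ y ℚ.+ ∑[ t < q ] (c (punchIn t₀ t) ℚ.* b′ t y) ≡ 0ℚ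
    others≡ = trans (sym (sum-remove (λ t → c t ℚ.* b t y))) (cb≡0 y)
    reassociate : ∀ u v w → u ℚ.* ℚ.- (v ℚ.* w) ≡ ℚ.- (u ℚ.* v ℚ.* w)
    reassociate = solve 3 (λ u v w → u :* (:- (v :* w)) := :- (u :* v :* w)) refl

  F≡a′b′ : Factorises F a′ b′
  F≡a′b′ x y = begin
    F x y                                              ≡⟨ F≡ab x y ⟩
    ∑[ t < suc q ] (a t x ℚ.* b t y)                   ≡⟨ sum-remove (λ t → a t x ℚ.* b t y) ⟩
    a t₀ x ℚ.* b t₀ y ℚ.+ T                            ≡⟨ rearrange (a t₀ x) (b t₀ y) T ⟩
    T ℚ.- a t₀ x ℚ.* ℚ.- b t₀ y                        ≡⟨ cong (λ z → T ℚ.- a t₀ x ℚ.* z) (μb′≡-b₀ y) ⟨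
    T ℚ.- a t₀ x ℚ.* ∑[ t < q ] (μ t ℚ.* b′ t y)
      ≡⟨ cong (ℚ._-_ T) (*-distribˡ-sum (a t₀ x) (λ t → μ t ℚ.* b′ t y)) ⟩
    T ℚ.- ∑[ t < q ] (a t₀ x ℚ.* (μ t ℚ.* b′ t y))
      ≡⟨ ∑-distrib-- (λ t → a (punchIn t₀ t) x ℚ.* b′ t y) _ ⟨
    ∑[ t < q ] (a (punchIn t₀ t) x ℚ.* b′ t y ℚ.- a t₀ x ℚ.* (μ t ℚ.* b′ t y))
      ≡⟨ sum-cong-≗ (λ t → distrib (a (punchIn t₀ t) x) (a t₀ x) (μ t) (b′ t y)) ⟩
    ∑[ t < q ] (a′ t x ℚ.* b′ t y)                     ∎
    where
    T = ∑[ t < q ] (a (punchIn t₀ t) x ℚ.* b′ t y)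
    rearrange : ∀ u v w → u ℚ.* v ℚ.+ w ≡ w ℚ.- u ℚ.* ℚ.- v
    rearrange = solve 3 (λ u v w → u :* v :+ w := w :- u :* (:- v)) refl
    distrib : ∀ u v m w → u ℚ.* w ℚ.- v ℚ.* (m ℚ.* w) ≡ (u ℚ.- v ℚ.* m) ℚ.* w
    distrib = solve 4 (λ u v m w → u :* w :- v :* (m :* w) := (u :- v :* m) :* w) refl

combination-factorises :
  ∀ {X Y : Set} {F : X → Y → ℚ} {q} {a : Fin q → X → ℚ} {b : Fin q → Y → ℚ} →
  Factorises F a b → ∀ {N} (w : Fin N → ℚ) (e : Fin N → X) y →
  ∑[ j < N ] (w j ℚ.* F (e j) y) ≡ ∑[ t < q ] (∑[ j < N ] (w j ℚ.* a t (e j)) ℚ.* b t y)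
combination-factorises {F = F} {q} {a} {b} F≡ab {N} w e y = begin
  ∑[ j < N ] (w j ℚ.* F (e j) y)
    ≡⟨ sum-cong-≗ (λ j → cong (w j ℚ.*_) (F≡ab (e j) y)) ⟩
  ∑[ j < N ] (w j ℚ.* ∑[ t < q ] (a t (e j) ℚ.* b t y))
    ≡⟨ sum-cong-≗ (λ j → *-distribˡ-sum (w j) (λ t → a t (e j) ℚ.* b t y)) ⟩
  ∑[ j < N ] ∑[ t < q ] (w j ℚ.* (a t (e j) ℚ.* b t y))
    ≡⟨ ∑-comm (λ j t → w j ℚ.* (a t (e j) ℚ.* b t y)) ⟩
  ∑[ t < q ] ∑[ j < N ] (w j ℚ.* (a t (e j) ℚ.* b t y))
    ≡⟨ sum-cong-≗ (λ t → sum-cong-≗ (λ j → sym (ℚ.*-assoc (w j) (a t (e j)) (b t y)))) ⟩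
  ∑[ t < q ] ∑[ j < N ] (w j ℚ.* a t (e j) ℚ.* b t y)
    ≡⟨ sum-cong-≗ (λ t → *-distribʳ-sum (b t y) (λ j → w j ℚ.* a t (e j))) ⟨
  ∑[ t < q ] (∑[ j < N ] (w j ℚ.* a t (e j)) ℚ.* b t y)
    ∎

rankAtMost-leftNull : ∀ {X Y : Set} {F : X → Y → ℚ} {q} {a : Fin (suc q) → X → ℚ} {b} →
  Factorises F a b → ∀ {N} (w : Fin N → ℚ) (e : Fin N → X) →
  (∀ y → ∑[ j < N ] (w j ℚ.* F (e j) y) ≡ 0ℚ) →
  ∀ t₀ → ∑[ j < N ] (w j ℚ.* a t₀ (e j)) ≢ 0ℚ → RankAtMost F q
rankAtMost-leftNull {a = a} {b} F≡ab {N} w e wF≡0 t₀ wa≢0 =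
  rankAtMost-removeDependent {a = a} {b} F≡ab (λ t → ∑[ j < N ] (w j ℚ.* a t (e j))) t₀ wa≢0 λ y →
    trans (sym (combination-factorises {a = a} {b} F≡ab w e y)) (wF≡0 y)

rankAtMost-rightNull : ∀ {X Y : Set} {F : X → Y → ℚ} {q} {a : Fin (suc q) → X → ℚ} {b} →
  Factorises F a b → ∀ {N} (w : Fin N → ℚ) (e : Fin N → Y) →
  (∀ x → ∑[ j < N ] (w j ℚ.* F x (e j)) ≡ 0ℚ) →
  ∀ t₀ → ∑[ j < N ] (w j ℚ.* b t₀ (e j)) ≢ 0ℚ → RankAtMost F q
rankAtMost-rightNull {a = a} {b} F≡ab w e Fw≡0 t₀ wb≢0 =
  rankAtMost-flip (rankAtMost-leftNull {a = b} {a} (factorises-flip {a = a} {b} F≡ab) w e Fw≡0 t₀ wb≢0)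

rowsIndependent⇒≤rank : ∀ {I : Set} (M : I → I → Bool) {q r} {f : Fin r → I} →
  RankAtMost (λ x y → toℚ (M x y)) q → RowsIndependent M r f → r ≤ q
rowsIndependent⇒≤rank M {q} {r} {f} (a , b , M≡ab) independent =
  decidable-stable (r ≤? q) λ r≰q →
    let c , (s , cₛ≢0) , cA≡0 = rows-dependent (≰⇒> r≰q) (λ s t → a t (f s))
    in cₛ≢0 (independent c (λ y → begin
      sumℚ r (λ s → c s ℚ.* toℚ (M (f s) y))                    ≡⟨ sumℚ≡sum r _ ⟩
      ∑[ s < r ] (c s ℚ.* toℚ (M (f s) y))                      ≡⟨ combination-factorises {a = a} {b} M≡ab c f y ⟩
      ∑[ t < q ] (∑[ s < r ] (c s ℚ.* a t (f s)) ℚ.* b t y)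
        ≡⟨ sum-zero (λ t → trans (cong (ℚ._* b t y) (cA≡0 t)) (ℚ.*-zeroˡ (b t y))) ⟩
      0ℚ                                                        ∎) s)

toℚ*toℚ≡0 : ∀ {b₁ b₂} → (b₁ ≡ true → b₂ ≡ true → ⊥) → toℚ b₁ ℚ.* toℚ b₂ ≡ 0ℚ
toℚ*toℚ≡0 {true}  {true}  both = ⊥-elim (both refl refl)
toℚ*toℚ≡0 {true}  {false} _    = refl
toℚ*toℚ≡0 {false} {b₂}    _    = ℚ.*-zeroˡ (toℚ b₂)

partition⇒factorises : ∀ {I : Set} {M : I → I → Bool} {p} {P : Fin p → Rect I} → IsPartition M p P →
  Factorises (λ x y → toℚ (M x y)) (λ t x → toℚ (rows (P t) x)) (λ t y → toℚ (cols (P t) y))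
partition⇒factorises {M = M} {p} {P} (oneRects , cover) x y with M x y in Mxy
... | true  = let (t₀ , (x∈ , y∈)) , unique = cover x y Mxy in sym (begin
  ∑[ t < p ] (toℚ (rows (P t) x) ℚ.* toℚ (cols (P t) y))
    ≡⟨ sum-delta t₀ (λ t t≢t₀ → toℚ*toℚ≡0 (λ x∈′ y∈′ → t≢t₀ (unique t t₀ (x∈′ , y∈′) (x∈ , y∈)))) ⟩
  toℚ (rows (P t₀) x) ℚ.* toℚ (cols (P t₀) y)
    ≡⟨ cong₂ (λ u v → toℚ u ℚ.* toℚ v) x∈ y∈ ⟩
  1ℚ
    ∎)
... | false = sym (sum-zero (λ t → toℚ*toℚ≡0 (λ x∈ y∈ →
  true≢false (trans (sym (proj₂ (proj₂ (oneRects t)) x y x∈ y∈)) Mxy))))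
  where
  true≢false : true ≢ false
  true≢false ()

-- Periodic sums and cyclic windows

-- ∑_{x < n} h x. Unlike ∑ over Fin n it is defined by recursion on n, so n and h are recovered by unification.
sumBelow : ℕ → (ℕ → ℚ) → ℚ
sumBelow zero    h = 0ℚ
sumBelow (suc n) h = h 0 ℚ.+ sumBelow n (h ∘ suc)

sumBelow≡∑ : ∀ n h → sumBelow n h ≡ ∑[ x < n ] h (toℕ x)
sumBelow≡∑ zero    h = refl
sumBelow≡∑ (suc n) h = cong (h 0 ℚ.+_) (sumBelow≡∑ n (h ∘ suc))

sumBelow-+ : ∀ a b h → sumBelow (a + b) h ≡ sumBelow a h ℚ.+ sumBelow b (λ y → h (a + y))
sumBelow-+ zero    b h = sym (ℚ.+-identityˡ _)
sumBelow-+ (suc a) b h = trans (cong (h 0 ℚ.+_) (sumBelow-+ a b (h ∘ suc)))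
  (sym (ℚ.+-assoc (h 0) (sumBelow a (h ∘ suc)) (sumBelow b (λ y → h (suc a + y)))))

sumBelow-cong : ∀ {n g h} → (∀ x → x < n → g x ≡ h x) → sumBelow n g ≡ sumBelow n h
sumBelow-cong {zero}  g≡h = refl
sumBelow-cong {suc n} g≡h = cong₂ ℚ._+_ (g≡h 0 z<s) (sumBelow-cong (λ x x<n → g≡h (suc x) (s<s x<n)))

sumBelow-zero : ∀ {n h} → (∀ x → x < n → h x ≡ 0ℚ) → sumBelow n h ≡ 0ℚ
sumBelow-zero {n} {h} h≡0 = trans (sumBelow-cong {n} {h} {λ _ → 0ℚ} h≡0) (zeros n)
  where
  zeros : ∀ n → sumBelow n (λ _ → 0ℚ) ≡ 0ℚ
  zeros zero    = refl
  zeros (suc n) = cong (0ℚ ℚ.+_) (zeros n)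

sumBelow-distrib-- : ∀ n f g → sumBelow n (λ x → f x ℚ.- g x) ≡ sumBelow n f ℚ.- sumBelow n g
sumBelow-distrib-- n f g = begin
  sumBelow n (λ x → f x ℚ.- g x)                   ≡⟨ sumBelow≡∑ n _ ⟩
  ∑[ x < n ] (f (toℕ x) ℚ.- g (toℕ x))             ≡⟨ ∑-distrib-- {n} (f ∘ toℕ) (g ∘ toℕ) ⟩
  ∑[ x < n ] f (toℕ x) ℚ.- ∑[ x < n ] g (toℕ x)    ≡⟨ cong₂ ℚ._-_ (sumBelow≡∑ n f) (sumBelow≡∑ n g) ⟨
  sumBelow n f ℚ.- sumBelow n g                    ∎

Periodic : ℕ → (ℕ → ℚ) → Set
Periodic p h = ∀ x → h (p + x) ≡ h x

periodic-suc : ∀ {p h} → Periodic p h → Periodic p (h ∘ suc)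
periodic-suc {p} {h} per x = trans (cong h (sym (+-suc p x))) (per (suc x))

periodic-∣ : ∀ {p n h} → Periodic p h → p ∣ n → Periodic n h
periodic-∣ {p} {h = h} per (divides q refl) = multiple q
  where
  multiple : ∀ q → Periodic (q * p) h
  multiple zero    x = refl
  multiple (suc q) x = trans (cong h (+-assoc p (q * p) x)) (trans (per (q * p + x)) (multiple q x))

sumBelow-rotate : ∀ {p} h → Periodic p h → sumBelow p (h ∘ suc) ≡ sumBelow p h
sumBelow-rotate {zero}  h per = refl
sumBelow-rotate {suc p} h per = begin
  sumBelow (suc p) (h ∘ suc)                         ≡⟨ cong (λ n → sumBelow n (h ∘ suc)) (+-comm 1 p) ⟩
  sumBelow (p + 1) (h ∘ suc)                         ≡⟨ sumBelow-+ p 1 (h ∘ suc) ⟩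
  sumBelow p (h ∘ suc) ℚ.+ (h (suc p + 0) ℚ.+ 0ℚ)    ≡⟨ cong (λ z → sumBelow p (h ∘ suc) ℚ.+ (z ℚ.+ 0ℚ)) (per 0) ⟩
  sumBelow p (h ∘ suc) ℚ.+ (h 0 ℚ.+ 0ℚ)              ≡⟨ cong (sumBelow p (h ∘ suc) ℚ.+_) (ℚ.+-identityʳ (h 0)) ⟩
  sumBelow p (h ∘ suc) ℚ.+ h 0                       ≡⟨ ℚ.+-comm _ (h 0) ⟩
  sumBelow (suc p) h                                 ∎

sumBelow-shift : ∀ {p} h → Periodic p h → ∀ a → sumBelow p (λ y → h (a + y)) ≡ sumBelow p h
sumBelow-shift h per zero    = refl
sumBelow-shift h per (suc a) = trans (sumBelow-shift (h ∘ suc) (periodic-suc per) a) (sumBelow-rotate h per)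

sumBelow-periods : ∀ {p L} h → Periodic p h → sumBelow p h ≡ 0ℚ → p ∣ L →
  ∀ a → sumBelow L (λ y → h (a + y)) ≡ 0ℚ
sumBelow-periods {p} h per period≡0 (divides q refl) = periods q
  where
  periods : ∀ q a → sumBelow (q * p) (λ y → h (a + y)) ≡ 0ℚ
  periods zero    a = refl
  periods (suc q) a = begin
    sumBelow (p + q * p) (λ y → h (a + y))
      ≡⟨ sumBelow-+ p (q * p) (λ y → h (a + y)) ⟩
    sumBelow p (λ y → h (a + y)) ℚ.+ sumBelow (q * p) (λ y → h (a + (p + y)))
      ≡⟨ cong₂ ℚ._+_ (trans (sumBelow-shift h per a) period≡0)
                     (trans (sumBelow-cong {q * p} (λ y _ → cong h (sym (+-assoc a p y)))) (periods q (a + p))) ⟩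
    0ℚ
      ∎

sumBelow-rotation : ∀ {n a} → a ≤ n → ∀ {G g : ℕ → ℚ} →
  (∀ x → x < a → G x ≡ g (n ∸ a + x)) → (∀ y → y < n ∸ a → G (a + y) ≡ g y) →
  sumBelow n G ≡ sumBelow n g
sumBelow-rotation {n} {a} a≤n {G} {g} G≡g-head G≡g-tail = begin
  sumBelow n G                                             ≡⟨ cong (λ l → sumBelow l G) (m+[n∸m]≡n a≤n) ⟨
  sumBelow (a + (n ∸ a)) G                                 ≡⟨ sumBelow-+ a (n ∸ a) G ⟩
  sumBelow a G ℚ.+ sumBelow (n ∸ a) (λ y → G (a + y))
    ≡⟨ cong₂ ℚ._+_ (sumBelow-cong {a} G≡g-head) (sumBelow-cong {n ∸ a} G≡g-tail) ⟩
  sumBelow a (λ x → g (n ∸ a + x)) ℚ.+ sumBelow (n ∸ a) g  ≡⟨ ℚ.+-comm (sumBelow a (λ x → g (n ∸ a + x))) _ ⟩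
  sumBelow (n ∸ a) g ℚ.+ sumBelow a (λ x → g (n ∸ a + x))  ≡⟨ sumBelow-+ (n ∸ a) a g ⟨
  sumBelow (n ∸ a + a) g                                   ≡⟨ cong (λ l → sumBelow l g) (m∸n+n≡m a≤n) ⟩
  sumBelow n g                                             ∎

sumBelow-indicator : ∀ {L n} → L ≤ n → ∀ f → sumBelow n (λ y → f y ℚ.* toℚ (y <ᵇ L)) ≡ sumBelow L f
sumBelow-indicator {L} {n} L≤n f = begin
  sumBelow n g                                         ≡⟨ cong (λ l → sumBelow l g) (m+[n∸m]≡n L≤n) ⟨
  sumBelow (L + (n ∸ L)) g                             ≡⟨ sumBelow-+ L (n ∸ L) g ⟩
  sumBelow L g ℚ.+ sumBelow (n ∸ L) (λ y → g (L + y))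
    ≡⟨ cong₂ ℚ._+_ (sumBelow-cong {L} inside) (sumBelow-zero {n ∸ L} outside) ⟩
  sumBelow L f ℚ.+ 0ℚ                                  ≡⟨ ℚ.+-identityʳ _ ⟩
  sumBelow L f                                         ∎
  where
  g = λ y → f y ℚ.* toℚ (y <ᵇ L)
  inside : ∀ y → y < L → g y ≡ f y
  inside y y<L = trans (cong (λ b → f y ℚ.* toℚ b) (dec-true (y <? L) y<L)) (ℚ.*-identityʳ (f y))
  outside : ∀ y → y < n ∸ L → g (L + y) ≡ 0ℚ
  outside y _ =
    trans (cong (λ b → f (L + y) ℚ.* toℚ b) (dec-false (L + y <? L) (m+n≮m L y))) (ℚ.*-zeroʳ (f (L + y)))

cdiff-≤ : ∀ n {j j′} → j ≤ j′ → cdiff n j j′ ≡ j′ ∸ j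
cdiff-≤ n {j} {j′} j≤j′ = cong (λ b → if b then j′ ∸ j else n + j′ ∸ j) (dec-true (j ≤? j′) j≤j′)

cdiff-> : ∀ n {j j′} → j′ < j → cdiff n j j′ ≡ n + j′ ∸ j
cdiff-> n {j} {j′} j′<j = cong (λ b → if b then j′ ∸ j else n + j′ ∸ j) (dec-false (j ≤? j′) (<⇒≱ j′<j))

sumBelow-window : ∀ {n h} → Periodic n h → ∀ {a L} → a ≤ n → L ≤ n →
  sumBelow n (λ x → h x ℚ.* toℚ (cdiff n a x <ᵇ L)) ≡ sumBelow L (λ y → h (a + y))
sumBelow-window {n} {h} per {a} {L} a≤n L≤n =
  trans (sumBelow-rotation a≤n before-a from-a) (sumBelow-indicator L≤n (λ y → h (a + y)))
  where
  before-a : ∀ x → x < a →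
    h x ℚ.* toℚ (cdiff n a x <ᵇ L) ≡ h (a + (n ∸ a + x)) ℚ.* toℚ (n ∸ a + x <ᵇ L)
  before-a x x<a = cong₂ (λ u v → u ℚ.* toℚ (v <ᵇ L))
    (trans (sym (per x)) (cong h (trans (cong (_+ x) (sym (m+[n∸m]≡n a≤n))) (+-assoc a (n ∸ a) x))))
    (trans (cdiff-> n x<a) (+-∸-comm x a≤n))
  from-a : ∀ y → y < n ∸ a → h (a + y) ℚ.* toℚ (cdiff n a (a + y) <ᵇ L) ≡ h (a + y) ℚ.* toℚ (y <ᵇ L)
  from-a y _ = cong (λ v → h (a + y) ℚ.* toℚ (v <ᵇ L)) (trans (cdiff-≤ n (m≤m+n a y)) (m+n∸m≡n a y))

cdiff-sum : ∀ {n x a} → x < n → a < n → suc (cdiff n x a + cdiff n (suc a) x) ≡ n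
cdiff-sum {n} {x} {a} x<n a<n with x ≤? a
... | yes x≤a = +-cancelʳ-≡ x _ n (begin
  suc (u + v) + x                      ≡⟨ shuffle u v x ⟩
  v + suc (u + x)                      ≡⟨ cong₂ (λ p q → p + suc (q + x)) (cdiff-> n (s≤s x≤a)) (cdiff-≤ n x≤a) ⟩
  (n + x ∸ suc a) + suc (a ∸ x + x)    ≡⟨ cong (λ z → (n + x ∸ suc a) + suc z) (m∸n+n≡m x≤a) ⟩
  (n + x ∸ suc a) + suc a              ≡⟨ m∸n+n≡m (≤-trans a<n (m≤m+n n x)) ⟩
  n + x                                ∎)
  where
  u = cdiff n x a
  v = cdiff n (suc a) x
  shuffle : ∀ u v x → suc (u + v) + x ≡ v + suc (u + x)
  shuffle = solve-∀
... | no x≰a = +-cancelʳ-≡ a _ n (begin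
  suc (u + v) + a                      ≡⟨ shuffle u v a ⟩
  u + (v + suc a)                      ≡⟨ cong₂ (λ p q → p + (q + suc a)) (cdiff-> n a<x) (cdiff-≤ n a<x) ⟩
  (n + a ∸ x) + (x ∸ suc a + suc a)    ≡⟨ cong ((n + a ∸ x) +_) (m∸n+n≡m a<x) ⟩
  (n + a ∸ x) + x                      ≡⟨ m∸n+n≡m (≤-trans (<⇒≤ x<n) (m≤m+n n a)) ⟩
  n + a                                ∎)
  where
  a<x = ≰⇒> x≰a
  u = cdiff n x a
  v = cdiff n (suc a) x
  shuffle : ∀ u v a → suc (u + v) + a ≡ u + (v + suc a)
  shuffle = solve-∀

-- The ones of column a of the complemented block form the cyclic window of length n ∸ K starting at a + 1.
cdiff-complement : ∀ {n K x a} → K ≤ n → x < n → a < n →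
  not (cdiff n x a <ᵇ K) ≡ (cdiff n (suc a) x <ᵇ n ∸ K)
cdiff-complement {n} {K} {x} {a} K≤n x<n a<n = does-⇔ (mk⇔ to from) (¬? (u <? K)) (v <? n ∸ K)
  where
  u = cdiff n x a
  v = cdiff n (suc a) x
  u+v+1≡n : suc (u + v) ≡ n
  u+v+1≡n = cdiff-sum x<n a<n
  to : ¬ u < K → v < n ∸ K
  to u≮K = m+n≤o⇒m≤o∸n (suc v)
    (≤-trans (+-monoʳ-≤ (suc v) (≮⇒≥ u≮K)) (≤-reflexive (trans (cong suc (+-comm v u)) u+v+1≡n)))
  from : v < n ∸ K → ¬ u < K
  from v<n∸K u<K = n≮n n (subst₂ _<_ u+v+1≡n (m+[n∸m]≡n K≤n) (+-mono-≤-< u<K v<n∸K))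

-- Residue classes

-- The indicator of x ≡ s (mod d), in the form used by classCount.
residue : ℕ → ℕ → ℕ → ℚ
residue d s x = toℚ (does (d ∣? ∣ x - s ∣))

∣∣x-s∣⇔x%d≡s : ∀ {d s x} .{{_ : NonZero d}} → s < d → d ∣ ∣ x - s ∣ ⇔ x % d ≡ s
∣∣x-s∣⇔x%d≡s {d} {s} {x} s<d = mk⇔ to from
  where
  to : d ∣ ∣ x - s ∣ → x % d ≡ s
  to d∣ with s ≤? x
  ... | yes s≤x with subst (d ∣_) (m≤n⇒∣n-m∣≡n∸m s≤x) d∣
  ...   | divides q x∸s≡qd = begin
    x % d              ≡⟨ %-congˡ (trans (sym (m+[n∸m]≡n s≤x)) (cong (s +_) x∸s≡qd)) ⟩
    (s + q * d) % d    ≡⟨ [m+kn]%n≡m%n s q d ⟩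
    s % d              ≡⟨ m<n⇒m%n≡m s<d ⟩
    s                  ∎
  to d∣ | no s≰x = ⊥-elim (>⇒∤ {{>-nonZero (m<n⇒0<n∸m x<s)}} (≤-<-trans (m∸n≤m s x) s<d)
                                (subst (d ∣_) (m≤n⇒∣m-n∣≡n∸m (<⇒≤ x<s)) d∣))
    where x<s = ≰⇒> s≰x
  from : x % d ≡ s → d ∣ ∣ x - s ∣
  from x%d≡s = subst (d ∣_) (sym (begin
    ∣ x - s ∣              ≡⟨ cong (λ z → ∣ z - s ∣) (trans (m≡m%n+[m/n]*n x d) (cong (_+ x / d * d) x%d≡s)) ⟩
    ∣ s + x / d * d - s ∣  ≡⟨ ∣-∣-comm (s + x / d * d) s ⟩
    ∣ s - s + x / d * d ∣  ≡⟨ ∣m-m+n∣≡n s (x / d * d) ⟩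
    x / d * d              ∎)) (n∣m*n (x / d))

residue-periodic : ∀ {d s} → s < d → Periodic d (residue d s)
residue-periodic {d} {s} s<d x = cong toℚ (does-⇔
  (mk⇔ (λ d∣ → from (trans (sym d+x≡x) (to d∣))) (λ d∣ → from (trans d+x≡x (to d∣))))
  (d ∣? ∣ d + x - s ∣) (d ∣? ∣ x - s ∣))
  where
  instance _ = >-nonZero (≤-<-trans z≤n s<d)
  to : ∀ {y} → d ∣ ∣ y - s ∣ → y % d ≡ s
  to = Equivalence.to (∣∣x-s∣⇔x%d≡s s<d)
  from : ∀ {y} → y % d ≡ s → d ∣ ∣ y - s ∣
  from = Equivalence.from (∣∣x-s∣⇔x%d≡s s<d)
  d+x≡x : (d + x) % d ≡ x % d
  d+x≡x = trans (%-congˡ (+-comm d x)) ([m+n]%n≡m%n x d)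

sumBelow-residue : ∀ {d s} → s < d → sumBelow d (residue d s) ≡ sumBelow d (residue d 0)
sumBelow-residue {d} {s} s<d = begin
  sumBelow d (residue d s)
    ≡⟨ sumBelow-shift {d} (residue d s) (residue-periodic s<d) s ⟨
  sumBelow d (λ y → residue d s (s + y))
    ≡⟨ sumBelow-cong {d} (λ y _ → cong (λ z → toℚ (does (d ∣? z))) (∣s+y-s∣≡∣y-0∣ y)) ⟩
  sumBelow d (residue d 0)
    ∎
  where
  ∣s+y-s∣≡∣y-0∣ : ∀ y → ∣ s + y - s ∣ ≡ ∣ y - 0 ∣
  ∣s+y-s∣≡∣y-0∣ y = trans (∣-∣-comm (s + y) s) (trans (∣m-m+n∣≡n s y) (sym (∣-∣-identityʳ y)))

weight : ℕ → ℕ → ℕ → ℕ → ℚ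
weight d s s′ x = residue d s x ℚ.- residue d s′ x

weight-periodic : ∀ {d s s′} → s < d → s′ < d → Periodic d (weight d s s′)
weight-periodic s<d s′<d x = cong₂ ℚ._-_ (residue-periodic s<d x) (residue-periodic s′<d x)

sumBelow-weight : ∀ {d s s′} → s < d → s′ < d → sumBelow d (weight d s s′) ≡ 0ℚ
sumBelow-weight {d} {s} {s′} s<d s′<d = begin
  sumBelow d (weight d s s′)
    ≡⟨ sumBelow-distrib-- d (residue d s) (residue d s′) ⟩
  sumBelow d (residue d s) ℚ.- sumBelow d (residue d s′)
    ≡⟨ cong₂ ℚ._-_ (sumBelow-residue s<d) (sumBelow-residue s′<d) ⟩
  sumBelow d (residue d 0) ℚ.- sumBelow d (residue d 0)
    ≡⟨ ℚ.+-inverseʳ (sumBelow d (residue d 0)) ⟩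
  0ℚ
    ∎

∣m∣n⇒∣m∸n : ∀ {d m n} → d ∣ m → d ∣ n → d ∣ m ∸ n
∣m∣n⇒∣m∸n {d} (divides p refl) (divides q refl) = divides (p ∸ q) (sym (*-distribʳ-∸ d p q))

ι : ℕ → ℚ
ι n = n Mult.× 1ℚ

ι-nonNegative : ∀ n → ℚ.NonNegative (ι n)
ι-nonNegative zero    = _
ι-nonNegative (suc n) = ℚ.nonNeg+nonNeg⇒nonNeg 1ℚ (ι n) {{ι-nonNegative n}}

ι-suc≢0 : ∀ n → ι (suc n) ≢ 0ℚ
ι-suc≢0 n ι≡0 = ℚ.<⇒≢ (ℚ.positive⁻¹ (ι (suc n)) {{positive}}) (sym ι≡0)
  where positive = ℚ.pos+nonNeg⇒pos 1ℚ (ι n) {{ι-nonNegative n}}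

ι-injective : ∀ {m n} → ι m ≡ ι n → m ≡ n
ι-injective {zero}  {zero}  _  = refl
ι-injective {zero}  {suc n} eq = ⊥-elim (ι-suc≢0 n (sym eq))
ι-injective {suc m} {zero}  eq = ⊥-elim (ι-suc≢0 m eq)
ι-injective {suc m} {suc n} eq = cong suc (ι-injective (∙-cancelˡ 1ℚ (ι m) (ι n) eq))

ι-sumℕ : ∀ r g → ι (sumℕ r g) ≡ ∑[ t < r ] ι (g t)
ι-sumℕ zero    g = refl
ι-sumℕ (suc r) g = trans (Mult.×-homo-+ 1ℚ (g Fin.zero) (sumℕ r (g ∘ Fin.suc)))
  (cong (ι (g Fin.zero) ℚ.+_) (ι-sumℕ r (g ∘ Fin.suc)))

classCount-ι : ∀ {m} {n : Fin m → ℕ} (S : Idx m n → Bool) i d s →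
  ι (classCount S i d s) ≡ ∑[ j < n i ] (residue d s (toℕ j) ℚ.* toℚ (S (i , j)))
classCount-ι {n = n} S i d s = trans (ι-sumℕ (n i) _) (sum-cong-≗ (λ j → ι-if (S (i , j)) _))
  where
  ι-if : ∀ b₁ b₂ → ι (if b₁ then (if b₂ then 1 else 0) else 0) ≡ toℚ b₂ ℚ.* toℚ b₁
  ι-if false b₂    = sym (ℚ.*-zeroʳ (toℚ b₂))
  ι-if true  true  = refl
  ι-if true  false = refl

unbalanced⇒weighted≢0 : ∀ {m} {n : Fin m → ℕ} (S : Idx m n → Bool) i d s s′ →
  classCount S i d s ≢ classCount S i d s′ →
  ∑[ j < n i ] (weight d s s′ (toℕ j) ℚ.* toℚ (S (i , j))) ≢ 0ℚ
unbalanced⇒weighted≢0 {n = n} S i d s s′ counts≢ weighted≡0 =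
  counts≢ (ι-injective (x∙y⁻¹≈ε⇒x≈y _ _ (begin
    ι (classCount S i d s) ℚ.- ι (classCount S i d s′)
      ≡⟨ cong₂ ℚ._-_ (classCount-ι S i d s) (classCount-ι S i d s′) ⟩
    ∑[ j < n i ] (residue d s (toℕ j) ℚ.* χ j) ℚ.- ∑[ j < n i ] (residue d s′ (toℕ j) ℚ.* χ j)
      ≡⟨ ∑-distrib-- {n i} (λ j → residue d s (toℕ j) ℚ.* χ j) _ ⟨
    ∑[ j < n i ] (residue d s (toℕ j) ℚ.* χ j ℚ.- residue d s′ (toℕ j) ℚ.* χ j)
      ≡⟨ sum-cong-≗ {n i} (λ j → sym ([y-z]x≈yx-zx (χ j) (residue d s (toℕ j)) (residue d s′ (toℕ j)))) ⟩
    ∑[ j < n i ] (weight d s s′ (toℕ j) ℚ.* χ j)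
      ≡⟨ weighted≡0 ⟩
    0ℚ
      ∎)))
  where
  χ = λ j → toℚ (S (i , j))

-- The complement of a circulant block diagonal matrix

complement-CBD-offBlock : ∀ {m} {k n : Fin m → ℕ} {i i′} (j : Fin (n i)) (j′ : Fin (n i′)) → i ≢ i′ →
  complement (CBD m k n) (i , j) (i′ , j′) ≡ true
complement-CBD-offBlock {i = i} {i′} j j′ i≢i′ with i Fin.≟ i′
... | yes i≡i′ = ⊥-elim (i≢i′ i≡i′)
... | no _     = refl

complement-CBD-onBlock : ∀ {m} {k n : Fin m → ℕ} {i} → k i ≤ n i → (j j′ : Fin (n i)) →
  complement (CBD m k n) (i , j) (i , j′) ≡ not (cdiff (n i) (toℕ j) (toℕ j′) <ᵇ k i)
complement-CBD-onBlock {k = k} {n} {i} k≤n j j′ with i Fin.≟ i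
... | yes _  = cong (λ K → not (cdiff (n i) (toℕ j) (toℕ j′) <ᵇ K)) (m∸[m∸n]≡n k≤n)
... | no i≢i = ⊥-elim (i≢i refl)

*-toℚ-not : ∀ x b → x ℚ.* toℚ (not b) ≡ x ℚ.- x ℚ.* toℚ b
*-toℚ-not x true  = begin
  x ℚ.* 0ℚ          ≡⟨ ℚ.*-zeroʳ x ⟩
  0ℚ                ≡⟨ ℚ.+-inverseʳ x ⟨
  x ℚ.- x           ≡⟨ cong (ℚ._-_ x) (ℚ.*-identityʳ x) ⟨
  x ℚ.- x ℚ.* 1ℚ    ∎
*-toℚ-not x false = begin
  x ℚ.* 1ℚ          ≡⟨ ℚ.*-identityʳ x ⟩
  x                 ≡⟨ ℚ.+-identityʳ x ⟨
  x ℚ.- 0ℚ          ≡⟨ cong (ℚ._-_ x) (ℚ.*-zeroʳ x) ⟨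
  x ℚ.- x ℚ.* 0ℚ    ∎

module BlockNullVector {m} (k n : Fin m → ℕ) (i : Fin m) (k≤n : k i ≤ n i) {d} {h : ℕ → ℚ}
  (h-periodic : Periodic d h) (h-period≡0 : sumBelow d h ≡ 0ℚ) (d∣n : d ∣ n i) (d∣k : d ∣ k i) where

  private
    N = n i
    K = k i
    M = complement (CBD m k n)

    window≡0 : ∀ {L} → d ∣ L → ∀ a → sumBelow L (λ y → h (a + y)) ≡ 0ℚ
    window≡0 = sumBelow-periods {d} h h-periodic h-period≡0

    h-periodicN : Periodic N h
    h-periodicN = periodic-∣ h-periodic d∣n

    weighted : (Fin N → Bool) → ℚ
    weighted e = ∑[ j < N ] (h (toℕ j) ℚ.* toℚ (e j))

    weighted≡sumBelow : ∀ {e : Fin N → Bool} (E : ℕ → Bool) → (∀ j → e j ≡ E (toℕ j)) →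
      weighted e ≡ sumBelow N (λ x → h x ℚ.* toℚ (E x))
    weighted≡sumBelow E e≡E = trans (sum-cong-≗ {N} (λ j → cong (λ b → h (toℕ j) ℚ.* toℚ b) (e≡E j)))
                                    (sym (sumBelow≡∑ N (λ x → h x ℚ.* toℚ (E x))))

    otherBlock≡0 : sumBelow N (λ x → h x ℚ.* toℚ true) ≡ 0ℚ
    otherBlock≡0 = trans (sumBelow-cong {N} (λ x _ → ℚ.*-identityʳ (h x))) (window≡0 d∣n 0)

    column≡0 : ∀ {a} → a < N → sumBelow N (λ x → h x ℚ.* toℚ (not (cdiff N x a <ᵇ K))) ≡ 0ℚ
    column≡0 {a} a<N = begin
      sumBelow N (λ x → h x ℚ.* toℚ (not (cdiff N x a <ᵇ K)))
        ≡⟨ sumBelow-cong {N} (λ x x<N → cong (λ b → h x ℚ.* toℚ b) (cdiff-complement k≤n x<N a<N)) ⟩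
      sumBelow N (λ x → h x ℚ.* toℚ (cdiff N (suc a) x <ᵇ N ∸ K))
        ≡⟨ sumBelow-window {N} h-periodicN a<N (m∸n≤m N K) ⟩
      sumBelow (N ∸ K) (λ y → h (suc a + y))
        ≡⟨ window≡0 (∣m∣n⇒∣m∸n d∣n d∣k) (suc a) ⟩
      0ℚ
        ∎

    row≡0 : ∀ {a} → a < N → sumBelow N (λ x → h x ℚ.* toℚ (not (cdiff N a x <ᵇ K))) ≡ 0ℚ
    row≡0 {a} a<N = begin
      sumBelow N (λ x → h x ℚ.* toℚ (not (cdiff N a x <ᵇ K)))
        ≡⟨ sumBelow-cong {N} (λ x _ → *-toℚ-not (h x) (cdiff N a x <ᵇ K)) ⟩
      sumBelow N (λ x → h x ℚ.- h x ℚ.* toℚ (cdiff N a x <ᵇ K))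
        ≡⟨ sumBelow-distrib-- N h _ ⟩
      sumBelow N h ℚ.- sumBelow N (λ x → h x ℚ.* toℚ (cdiff N a x <ᵇ K))
        ≡⟨ cong₂ ℚ._-_ (window≡0 d∣n 0) (trans (sumBelow-window {N} h-periodicN (<⇒≤ a<N) k≤n) (window≡0 d∣k a)) ⟩
      0ℚ
        ∎

  leftNull : ∀ y → ∑[ j < N ] (h (toℕ j) ℚ.* toℚ (M (i , j) y)) ≡ 0ℚ
  leftNull (i′ , j′) = byBlock (i Fin.≟ i′) j′
    where
    byBlock : ∀ {i′} → Dec (i ≡ i′) → (j′ : Fin (n i′)) → weighted (λ j → M (i , j) (i′ , j′)) ≡ 0ℚ
    byBlock (no i≢i′) j′ =
      trans (weighted≡sumBelow (λ _ → true) (λ j → complement-CBD-offBlock {k = k} {n} j j′ i≢i′)) otherBlock≡0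
    byBlock (yes refl) j′ = trans
      (weighted≡sumBelow (λ x → not (cdiff N x (toℕ j′) <ᵇ K)) (λ j → complement-CBD-onBlock {k = k} {n} k≤n j j′))
      (column≡0 (toℕ<n j′))

  rightNull : ∀ x → ∑[ j < N ] (h (toℕ j) ℚ.* toℚ (M x (i , j))) ≡ 0ℚ
  rightNull (i′ , j′) = byBlock (i′ Fin.≟ i) j′
    where
    byBlock : ∀ {i′} → Dec (i′ ≡ i) → (j′ : Fin (n i′)) → weighted (λ j → M (i′ , j′) (i , j)) ≡ 0ℚ
    byBlock (no i′≢i) j′ =
      trans (weighted≡sumBelow (λ _ → true) (λ j → complement-CBD-offBlock {k = k} {n} j′ j i′≢i)) otherBlock≡0
    byBlock (yes refl) j′ = trans
      (weighted≡sumBelow (λ x → not (cdiff N (toℕ j′) x <ᵇ K)) (λ j → complement-CBD-onBlock {k = k} {n} k≤n j′ j))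
      (row≡0 (toℕ<n j′))

module UnbalancedRectangle {m} {k n : Fin m → ℕ} (k≤n : ∀ i → k i ≤ n i) {p} {P : Fin (suc p) → Rect (Idx m n)}
  (partition : IsPartition (complement (CBD m k n)) (suc p) P) (t : Fin (suc p)) (i : Fin m) {s s′}
  (s<d : s < gcd (n i) (k i)) (s′<d : s′ < gcd (n i) (k i)) where

  private
    d = gcd (n i) (k i)
    w = weight d s s′
    M = complement (CBD m k n)
    χrows = λ t x → toℚ (rows (P t) x)
    χcols = λ t y → toℚ (cols (P t) y)

    M≡χrows⊗χcols : Factorises (λ x y → toℚ (M x y)) χrows χcols
    M≡χrows⊗χcols = partition⇒factorises partition

  open BlockNullVector k n i (k≤n i) (weight-periodic s<d s′<d) (sumBelow-weight s<d s′<d)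
    (gcd[m,n]∣m (n i) (k i)) (gcd[m,n]∣n (n i) (k i))

  rows⇒rankAtMost : classCount (rows (P t)) i d s ≢ classCount (rows (P t)) i d s′ →
    RankAtMost (λ x y → toℚ (M x y)) p
  rows⇒rankAtMost counts≢ = rankAtMost-leftNull {a = χrows} {χcols} M≡χrows⊗χcols (w ∘ toℕ) (i ,_) leftNull t
    (unbalanced⇒weighted≢0 (rows (P t)) i d s s′ counts≢)

  cols⇒rankAtMost : classCount (cols (P t)) i d s ≢ classCount (cols (P t)) i d s′ →
    RankAtMost (λ x y → toℚ (M x y)) p
  cols⇒rankAtMost counts≢ = rankAtMost-rightNull {a = χrows} {χcols} M≡χrows⊗χcols (w ∘ toℕ) (i ,_) rightNull t
    (unbalanced⇒weighted≢0 (cols (P t)) i d s s′ counts≢)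

corollary4p3 : (m : ℕ) → 1 ≤ m → (k n : Fin m → ℕ) → (∀ i → k i ≤ n i) →
    (p : ℕ) (P : Fin p → Rect (Idx m n)) →
    IsPartition (complement (CBD m k n)) p P →
    (Σ (Fin p) λ t → Σ (Fin m) λ i →
       (BalancedIn k n (rows (P t)) i → ⊥) ⊎ (BalancedIn k n (cols (P t)) i → ⊥)) →
    (r : ℕ) → IsRank (complement (CBD m k n)) r →
    r + 1 ≤ p
corollary4p3 m _ k n k≤n zero    P partition (() , _) r _
corollary4p3 m _ k n k≤n (suc p) P partition (t , i , unbalanced) r ((f , independent) , _) =
  decidable-stable (r + 1 ≤? suc p) λ r+1≰p →
    [ (λ ¬balanced → ¬balanced (balanced (rows (P t)) r+1≰p rows⇒rankAtMost))
    , (λ ¬balanced → ¬balanced (balanced (cols (P t)) r+1≰p cols⇒rankAtMost))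
    ] unbalanced
  where
  open UnbalancedRectangle k≤n partition t i
  M = complement (CBD m k n)
  d = gcd (n i) (k i)

  r+1≤ : RankAtMost (λ x y → toℚ (M x y)) p → r + 1 ≤ suc p
  r+1≤ rank≤p = subst (_≤ suc p) (+-comm 1 r) (s≤s (rowsIndependent⇒≤rank M {f = f} rank≤p independent))

  balanced : ∀ S → ¬ r + 1 ≤ suc p →
    (∀ {s s′} → s < d → s′ < d → classCount S i d s ≢ classCount S i d s′ →
      RankAtMost (λ x y → toℚ (M x y)) p) →
    BalancedIn k n S i
  balanced S r+1≰p unbalanced⇒rank s s′ s<d s′<d =
    decidable-stable (classCount S i d s ≟ classCount S i d s′) (r+1≰p ∘ r+1≤ ∘ unbalanced⇒rank s<d s′<d)
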